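{- Let $n\ge1$, $\lambda\subseteq\delta_n$, and $m=(m_{ij})\in\mathcal{P}_\lambda(n)$. For $1\le i,j\le n$ put $c_{i,j}=\sum_{1\le i'\le i,\ j\le j'\le n}m_{i',j'}$, and define $g_m:\delta_n\setminus\lambda\to\mathbb{R}$ by $g_m(i,j)=1-c_{i,j}$. Then $g_m$ (viewed as the point $(g_m(p_{ij}))$ with $g_m(p_{ij}):=g_m(i,j)$) lies in the order polytope $\mathcal{O}\big((\delta_n\setminus\lambda)^*\big)$.
   Context: $\mathcal{A}(n)$ is the set of real $n\times n$ matrices $(a_{ij})$ with $0\le\sum_{i=1}^{i'}a_{ij}\le1$ for all $1\le i',j\le n$, $0\le\sum_{j=1}^{j'}a_{ij}\le1$ for all $1\le j',i\le n$, and all full row and column sums equal to $1$. $\delta_n=(n-1,\dots,1)$ is identified with the set of positions $\{(i,j):1\le i<j\le n\}$; a partition $\lambda=(\lambda_1,\dots,\lambda_k)\subseteq\delta_n$ is identified with $\{(i,j):1\le i\le k,\ n-\lambda_i+1\le j\le n\}$. $\mathcal{P}_\lambda(n)=\{(a_{ij})\in\mathcal{A}(n):a_{ij}=0 \text{ whenever } i-j\ge2 \text{ and whenever }(i,j)\in\lambda\}$. The poset $(\delta_n\setminus\lambda)^*$ has elements $p_{ij}$, $(i,j)\in\delta_n\setminus\lambda$, with $p_{ij}\le p_{i'j'}$ iff $i\ge i'$ and $j\le j'$. For a finite poset $P$, $\mathcal{O}(P)=\{x\in[0,1]^P:x_s\le x_t\text{ whenever } s\le_P t\}$. -}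

module Defs where

open import Level using (Level; _⊔_) renaming (suc to lsuc)
open import Data.Nat as ℕ using (ℕ; zero; suc)
open import Data.Fin as F using (Fin; zero; suc; toℕ)
open import Data.Product using (Σ; _×_; _,_; proj₁)
open import Relation.Nullary using (¬_)
open import Relation.Binary using (Rel; IsTotalOrder)
open import Algebra.Bundles using (CommutativeRing)

-- Ordered fields (the real numbers ℝ are the intended instance).
-- agda-stdlib has no reals; the statement is quantified over an
-- arbitrary ordered field.

record OrderedField (c ℓ₁ ℓ₂ : Level) : Set (lsuc (c ⊔ ℓ₁ ⊔ ℓ₂)) where
  field
    commutativeRing : CommutativeRing c ℓ₁
  open CommutativeRing commutativeRing public
  field
    _≤_          : Rel Carrier ℓ₂
    isTotalOrder : IsTotalOrder _≈_ _≤_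
    1≉0          : ¬ (1# ≈ 0#)
    _⁻¹          : (x : Carrier) → ¬ (x ≈ 0#) → Carrier
    ⁻¹-inverse   : ∀ x (p : ¬ (x ≈ 0#)) → x * (x ⁻¹) p ≈ 1#
    +-mono-≤     : ∀ {x y} z → x ≤ y → (x + z) ≤ (y + z)
    *-nonneg     : ∀ {x y} → 0# ≤ x → 0# ≤ y → 0# ≤ (x * y)

module _ {c ℓ₁ ℓ₂} (K : OrderedField c ℓ₁ ℓ₂) where
  open OrderedField K using (Carrier; _+_; _-_; 0#; 1#; _≈_; _≤_)

  sumAll : ∀ {n} → (Fin n → Carrier) → Carrier
  sumAll {zero}  f = 0#
  sumAll {suc n} f = f zero + sumAll (λ k → f (suc k))

  sumTo : ∀ {n} → (Fin n → Carrier) → Fin n → Carrier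
  sumTo f zero    = f zero
  sumTo f (suc i) = f zero + sumTo (λ k → f (suc k)) i

  sumFrom : ∀ {n} → (Fin n → Carrier) → Fin n → Carrier
  sumFrom f zero    = sumAll f
  sumFrom f (suc j) = sumFrom (λ k → f (suc k)) j

  Matrix : ℕ → Set c
  Matrix n = Fin n → Fin n → Carrier

  -- 𝒜(n): alternating-sign-matrix polytope
  -- (row index i, column index j; 0-based)
  InA : ∀ {n} → Matrix n → Set (ℓ₁ ⊔ ℓ₂)
  InA {n} a =
      (∀ (i' j : Fin n) → (0# ≤ sumTo (λ i → a i j) i') × (sumTo (λ i → a i j) i' ≤ 1#))
    × (∀ (i j' : Fin n) → (0# ≤ sumTo (λ j → a i j) j') × (sumTo (λ j → a i j) j' ≤ 1#))
    × (∀ (j : Fin n) → sumAll (λ i → a i j) ≈ 1#)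
    × (∀ (i : Fin n) → sumAll (λ j → a i j) ≈ 1#)

-- Partitions λ ⊆ δ_n.
-- A partition (λ_1,…,λ_k) is recorded as a function Fin n → ℕ
-- (0-based row index i ↦ λ_{i+1}), padded with zeros after row k.

IsPartitionIn-δ : (n : ℕ) → (Fin n → ℕ) → Set
IsPartitionIn-δ n lam =
    (∀ (i i' : Fin n) → toℕ i ℕ.≤ toℕ i' → lam i' ℕ.≤ lam i)
  × (∀ (i : Fin n) → lam i ℕ.+ toℕ i ℕ.< n)                    -- λ_i ≤ n - i (1-based)

-- (i,j) ∈ λ  (1-based: n - λ_i + 1 ≤ j;  0-based: n ≤ j + λ_i)
_∈λ[_] : ∀ {n} → Fin n × Fin n → (Fin n → ℕ) → Set
_∈λ[_] {n} (i , j) lam = n ℕ.≤ toℕ j ℕ.+ lam i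

_∈δ : ∀ {n} → Fin n × Fin n → Set
(i , j) ∈δ = toℕ i ℕ.< toℕ j

δ∖λ : (n : ℕ) → (Fin n → ℕ) → Set
δ∖λ n lam = Σ (Fin n × Fin n) (λ p → p ∈δ × ¬ (p ∈λ[ lam ]))

_≤*_ : ∀ {n lam} → δ∖λ n lam → δ∖λ n lam → Set
((i , j) , _) ≤* ((i' , j') , _) = (toℕ i' ℕ.≤ toℕ i) × (toℕ j ℕ.≤ toℕ j')

module _ {c ℓ₁ ℓ₂} (K : OrderedField c ℓ₁ ℓ₂) where
  open OrderedField K using (Carrier; _-_; 0#; 1#; _≈_; _≤_)

  InP : ∀ {n} → (Fin n → ℕ) → Matrix K n → Set (ℓ₁ ⊔ ℓ₂)
  InP {n} lam a =
      InA K a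
    × (∀ (i j : Fin n) → 2 ℕ.+ toℕ j ℕ.≤ toℕ i → a i j ≈ 0#)
    × (∀ (i j : Fin n) → (i , j) ∈λ[ lam ] → a i j ≈ 0#)

  InOrderPolytope : ∀ {e r} (E : Set e) (_≤P_ : E → E → Set r) → (E → Carrier) → Set (e ⊔ r ⊔ ℓ₂)
  InOrderPolytope E _≤P_ x =
      (∀ s → (0# ≤ x s) × (x s ≤ 1#))
    × (∀ s t → s ≤P t → x s ≤ x t)

  cc : ∀ {n} → Matrix K n → Fin n → Fin n → Carrier
  cc m i j = sumTo K (λ i' → sumFrom K (λ j' → m i' j') j) i

  g : ∀ {n lam} → Matrix K n → δ∖λ n lam → Carrier
  g m ((i , j) , _) = 1# - cc m i j

module Submission where

-- Index from 0 and extend m by zeros to an ℕ × ℕ matrix M, with row prefix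
-- sums row i b = Σ_{j<b} M i j and column prefix sums col j a = Σ_{i<a} M i j.
-- Since every row of m sums to 1, c_{i,j} = corner (i+1) j, where
-- corner a b = Σ_{i<a} (1 - row i b) is the sum over rows < a, columns ≥ b.
-- Adding a row adds 1 - row a b ≥ 0 and adding a column subtracts
-- col b a ≥ 0, so corner increases with a and decreases with b.  At full
-- width corner a n = 0, and on the diagonal corner a a = row a a ≤ 1 because
-- the column sums are 1 and m vanishes below the subdiagonal.  For i < j this
-- squeezes 0 ≤ c_{i,j} ≤ 1, and monotonicity of c gives that of g = 1 - c.  The zeros prescribed by λ are unused.

open import Defs
open import Level using (Level)
open import Data.Nat using (ℕ; _≥_)
open import Data.Fin using (Fin)

open import Data.Nat as ℕ using (zero; suc; s≤s; z≤n; _≤′_; ≤′-refl; ≤′-step)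
import Data.Nat.Properties as ℕP
open import Data.Fin as F using (toℕ; fromℕ<)
import Data.Fin.Properties as FP
open import Data.Product using (_×_; _,_; proj₁; proj₂; ∃-syntax)
open import Data.Sum using (_⊎_; inj₁; inj₂; [_,_]′)
open import Data.Empty using (⊥-elim)
open import Data.Maybe using (nothing)
open import Function using (flip)
open import Relation.Binary using (Rel; Reflexive; Transitive; IsTotalOrder; Poset; _Respects_)
open import Relation.Binary.PropositionalEquality as PE using (_≡_)
open import Tactic.RingSolver.Core.AlmostCommutativeRing using (fromCommutativeRing)

stepwise : ∀ {a r} {A : Set a} (_∼_ : Rel A r) → Reflexive _∼_ → Transitive _∼_ →
           (F : ℕ → A) {p q : ℕ} → p ℕ.≤ q →
           (∀ k → p ℕ.≤ k → k ℕ.< q → F k ∼ F (suc k)) → F p ∼ F q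
stepwise _∼_ ∼-refl ∼-trans F {p} p≤q = go (ℕP.≤⇒≤′ p≤q)
  where
    go : ∀ {q} → p ≤′ q → (∀ k → p ℕ.≤ k → k ℕ.< q → F k ∼ F (suc k)) → F p ∼ F q
    go ≤′-refl        _    = ∼-refl
    go (≤′-step p≤′q) step =
      ∼-trans (go p≤′q (λ k p≤k k<q → step k p≤k (ℕP.m<n⇒m<1+n k<q)))
              (step _ (ℕP.≤′⇒≤ p≤′q) (ℕP.n<1+n _))

below-by-Fin : ∀ {n p} {P : ℕ → Set p} → (∀ (x : Fin n) → P (toℕ x)) → ∀ i → i ℕ.< n → P i
below-by-Fin {P = P} all-x i i<n = PE.subst P (FP.toℕ-fromℕ< i<n) (all-x (fromℕ< i<n))

module OrderedFieldFacts {c ℓ₁ ℓ₂} (K : OrderedField c ℓ₁ ℓ₂) where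
  open OrderedField K
  open IsTotalOrder isTotalOrder using (total; antisym; isPartialOrder)
  open import Algebra.Properties.Ring ring using (-1*x≈-x; -‿involutive; -0#≈0#)
  open import Algebra.Properties.AbelianGroup +-abelianGroup
    using (xyx⁻¹≈y; //-rightDividesˡ; //-rightDividesʳ)
  open import Tactic.RingSolver.NonReflective (fromCommutativeRing commutativeRing (λ _ → nothing))
    using (solve; _⊜_; _⊕_)

  poset : Poset c ℓ₁ ℓ₂
  poset = record { Carrier = Carrier ; _≈_ = _≈_ ; _≤_ = _≤_ ; isPartialOrder = isPartialOrder }

  open import Relation.Binary.Reasoning.PartialOrder poset

  y≈z-x : ∀ {x y z} → x + y ≈ z → y ≈ z - x
  y≈z-x {x} {y} x+y≈z = trans (sym (xyx⁻¹≈y x y)) (+-congʳ x+y≈z)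

  x≤x+d : ∀ x {d} → 0# ≤ d → x ≤ (x + d)
  x≤x+d x {d} 0≤d = begin
    x       ≈⟨ +-identityˡ x ⟨
    0# + x  ≤⟨ +-mono-≤ x 0≤d ⟩
    d + x   ≈⟨ +-comm d x ⟩
    x + d   ∎

  sub-antitone : ∀ {x y} z → x ≤ y → (z - y) ≤ (z - x)
  sub-antitone {x} {y} z x≤y = begin
    z - y                       ≈⟨ //-rightDividesˡ x (z - y) ⟨
    (z - y) - x + x             ≈⟨ +-comm _ x ⟩
    x + ((z - y) - x)           ≤⟨ +-mono-≤ _ x≤y ⟩
    y + ((z - y) - x)           ≈⟨ rearrange z y (- y) (- x) ⟩
    ((z - x) + y) - y           ≈⟨ //-rightDividesʳ y (z - x) ⟩
    z - x                       ∎
    where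
      rearrange : ∀ z y ny nx → y + ((z + ny) + nx) ≈ ((z + nx) + y) + ny
      rearrange = solve 4 (λ z y ny nx → (y ⊕ ((z ⊕ ny) ⊕ nx)) ⊜ (((z ⊕ nx) ⊕ y) ⊕ ny)) refl

  x-d≤x : ∀ x {d} → 0# ≤ d → (x - d) ≤ x
  x-d≤x x {d} 0≤d = begin
    x - d   ≤⟨ sub-antitone x 0≤d ⟩
    x - 0#  ≈⟨ +-congˡ -0#≈0# ⟩
    x + 0#  ≈⟨ +-identityʳ x ⟩
    x       ∎

  -- 1 is positive: otherwise 0 ≤ -1, hence 0 ≤ (-1)(-1) = 1 and 1 ≈ 0.
  0≤1 : 0# ≤ 1#
  0≤1 with total 0# 1#
  ... | inj₁ 0≤1 = 0≤1
  ... | inj₂ 1≤0 = ⊥-elim (1≉0 (antisym 1≤0 0≤[-1][-1]))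
    where
      0≤-1 : 0# ≤ (- 1#)
      0≤-1 = begin
        0#       ≈⟨ -‿inverseʳ 0# ⟨
        0# - 0#  ≤⟨ sub-antitone 0# 1≤0 ⟩
        0# - 1#  ≈⟨ +-identityˡ (- 1#) ⟩
        - 1#     ∎
      0≤[-1][-1] : 0# ≤ 1#
      0≤[-1][-1] = begin
        0#            ≤⟨ *-nonneg 0≤-1 0≤-1 ⟩
        - 1# * - 1#   ≈⟨ -1*x≈-x (- 1#) ⟩
        - (- 1#)      ≈⟨ -‿involutive 1# ⟩
        1#            ∎

  complement-nonneg : ∀ {x} → x ≤ 1# → 0# ≤ (1# - x)
  complement-nonneg {x} x≤1 = begin
    0#       ≈⟨ -‿inverseʳ 1# ⟨
    1# - 1#  ≤⟨ sub-antitone 1# x≤1 ⟩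
    1# - x   ∎

  complement≤1 : ∀ {x} → 0# ≤ x → (1# - x) ≤ 1#
  complement≤1 = x-d≤x 1#

module PrefixSums {c ℓ₁ ℓ₂} (K : OrderedField c ℓ₁ ℓ₂) where
  open OrderedField K
  open IsTotalOrder isTotalOrder using () renaming (refl to ≤-refl; trans to ≤-trans)
  open OrderedFieldFacts K using (x≤x+d)

  Σ< : ℕ → (ℕ → Carrier) → Carrier
  Σ< zero    G = 0#
  Σ< (suc k) G = Σ< k G + G k

  Σ<-cong : ∀ k {G H : ℕ → Carrier} → (∀ i → i ℕ.< k → G i ≈ H i) → Σ< k G ≈ Σ< k H
  Σ<-cong zero    G≈H = refl
  Σ<-cong (suc k) G≈H =
    +-cong (Σ<-cong k (λ i i<k → G≈H i (ℕP.m<n⇒m<1+n i<k))) (G≈H k (ℕP.n<1+n k))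

  Σ<-stable : ∀ {G p q} → p ℕ.≤ q → (∀ i → p ℕ.≤ i → i ℕ.< q → G i ≈ 0#) → Σ< q G ≈ Σ< p G
  Σ<-stable {G} p≤q zero-on =
    sym (stepwise _≈_ refl trans (λ k → Σ< k G) p≤q
          (λ k p≤k k<q → sym (trans (+-congˡ (zero-on k p≤k k<q)) (+-identityʳ _))))

  Σ<-mono : ∀ {G p q} → p ℕ.≤ q → (∀ i → p ℕ.≤ i → i ℕ.< q → 0# ≤ G i) → Σ< p G ≤ Σ< q G
  Σ<-mono {G} p≤q nonneg-on =
    stepwise _≤_ ≤-refl ≤-trans (λ k → Σ< k G) p≤q
      (λ k p≤k k<q → x≤x+d (Σ< k G) (nonneg-on k p≤k k<q))

  Σ<-shift : ∀ k (G : ℕ → Carrier) → Σ< (suc k) G ≈ G 0 + Σ< k (λ i → G (suc i))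
  Σ<-shift zero    G = +-comm 0# (G 0)
  Σ<-shift (suc k) G = trans (+-congʳ (Σ<-shift k G)) (+-assoc (G 0) _ _)

  extend : ∀ {n} → (Fin n → Carrier) → ℕ → Carrier
  extend {zero}  f k       = 0#
  extend {suc n} f zero    = f F.zero
  extend {suc n} f (suc k) = extend (λ x → f (F.suc x)) k

  extend-toℕ : ∀ {n} (f : Fin n → Carrier) x → extend f (toℕ x) ≡ f x
  extend-toℕ f F.zero    = PE.refl
  extend-toℕ f (F.suc x) = extend-toℕ (λ y → f (F.suc y)) x

  extend-cong : ∀ {n} {f g : Fin n → Carrier} → (∀ x → f x ≡ g x) → ∀ k → extend f k ≡ extend g k
  extend-cong {zero}  f≡g k       = PE.refl
  extend-cong {suc n} f≡g zero    = f≡g F.zero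
  extend-cong {suc n} f≡g (suc k) = extend-cong (λ x → f≡g (F.suc x)) k

  sumAll-Σ< : ∀ {n} (f : Fin n → Carrier) → sumAll K f ≈ Σ< n (extend f)
  sumAll-Σ< {zero}  f = refl
  sumAll-Σ< {suc n} f =
    trans (+-congˡ (sumAll-Σ< (λ x → f (F.suc x)))) (sym (Σ<-shift n (extend f)))

  sumTo-Σ< : ∀ {n} (f : Fin n → Carrier) i → sumTo K f i ≈ Σ< (suc (toℕ i)) (extend f)
  sumTo-Σ< f F.zero    = sym (+-identityˡ (f F.zero))
  sumTo-Σ< f (F.suc i) =
    trans (+-congˡ (sumTo-Σ< (λ x → f (F.suc x)) i)) (sym (Σ<-shift (suc (toℕ i)) (extend f)))

  Σ<+sumFrom : ∀ {n} (f : Fin n → Carrier) j → Σ< (toℕ j) (extend f) + sumFrom K f j ≈ sumAll K f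
  Σ<+sumFrom f F.zero    = +-identityˡ (sumAll K f)
  Σ<+sumFrom f (F.suc j) = begin
    Σ< (suc (toℕ j)) (extend f) + sumFrom K f' j     ≈⟨ +-congʳ (Σ<-shift (toℕ j) (extend f)) ⟩
    (f F.zero + Σ< (toℕ j) (extend f')) + sumFrom K f' j  ≈⟨ +-assoc (f F.zero) _ _ ⟩
    f F.zero + (Σ< (toℕ j) (extend f') + sumFrom K f' j)  ≈⟨ +-congˡ (Σ<+sumFrom f' j) ⟩
    f F.zero + sumAll K f'                               ∎
    where
      open import Relation.Binary.Reasoning.Setoid setoid
      f' = λ x → f (F.suc x)

  extend-prefix : ∀ {n} (f : Fin n → Carrier) b →
                  (Σ< b (extend f) ≈ 0#) ⊎ (∃[ i ] Σ< b (extend f) ≈ sumTo K f i)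
  extend-prefix {zero}  f b       = inj₁ (Σ<-stable {q = b} z≤n (λ _ _ _ → refl))
  extend-prefix {suc n} f zero    = inj₁ refl
  extend-prefix {suc n} f (suc b) with extend-prefix (λ x → f (F.suc x)) b
  ... | inj₁ tail≈0 =
    inj₂ (F.zero , trans (Σ<-shift b (extend f)) (trans (+-congˡ tail≈0) (+-identityʳ _)))
  ... | inj₂ (i , tail≈sumTo) =
    inj₂ (F.suc i , trans (Σ<-shift b (extend f)) (+-congˡ tail≈sumTo))

  extend-prefix-property : ∀ {n p} (P : Carrier → Set p) → P Respects _≈_ → P 0# →
                           (f : Fin n → Carrier) → (∀ i → P (sumTo K f i)) →
                           ∀ b → P (Σ< b (extend f))
  extend-prefix-property P resp P0 f P-sumTo b =
    [ (λ Σ≈0 → resp (sym Σ≈0) P0) , (λ { (i , Σ≈sumTo) → resp (sym Σ≈sumTo) (P-sumTo i) }) ]′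
      (extend-prefix f b)

module Corners {c ℓ₁ ℓ₂} (K : OrderedField c ℓ₁ ℓ₂) (M : ℕ → ℕ → OrderedField.Carrier K) where
  open OrderedField K
  open IsTotalOrder isTotalOrder using () renaming (refl to ≤-refl; trans to ≤-trans)
  open OrderedFieldFacts K using (poset; y≈z-x; x-d≤x; complement-nonneg)
  open PrefixSums K using (Σ<; Σ<-stable; Σ<-mono)
  open import Relation.Binary.Reasoning.PartialOrder poset
  open import Algebra.Properties.AbelianGroup +-abelianGroup using (//-rightDividesˡ)
  open import Tactic.RingSolver.NonReflective (fromCommutativeRing commutativeRing (λ _ → nothing))
    using (solve; _⊜_; _⊕_; ⊝_)

  row : ℕ → ℕ → Carrier
  row i b = Σ< b (M i)

  col : ℕ → ℕ → Carrier
  col j a = Σ< a (λ i → M i j)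

  -- When every row sums to 1, corner a b is the sum of the entries in rows < a
  -- and columns ≥ b.  Adding a row adds 1 - row a b by definition.
  corner : ℕ → ℕ → Carrier
  corner a b = Σ< a (λ i → 1# - row i b)

  corner-suc-col : ∀ a b → corner a (suc b) ≈ corner a b - col b a
  corner-suc-col zero    b = sym (-‿inverseʳ 0#)
  corner-suc-col (suc a) b = begin-equality
    corner a (suc b) + (1# - (row a b + M a b))        ≈⟨ +-congʳ (corner-suc-col a b) ⟩
    (corner a b - col b a) + (1# - (row a b + M a b))  ≈⟨ regroup (corner a b) (col b a) 1# (row a b) (M a b) ⟩
    (corner a b + (1# - row a b)) - (col b a + M a b)  ∎
    where
      regroup : ∀ N C o r x → (N - C) + (o - (r + x)) ≈ (N + (o - r)) - (C + x)
      regroup = solve 5 (λ N C o r x → ((N ⊕ (⊝ C)) ⊕ (o ⊕ (⊝ (r ⊕ x))))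
                                         ⊜ ((N ⊕ (o ⊕ (⊝ r))) ⊕ (⊝ (C ⊕ x)))) refl

  corner-mono-rows : ∀ b {a a'} → a ℕ.≤ a' → (∀ i → a ℕ.≤ i → i ℕ.< a' → row i b ≤ 1#) →
                     corner a b ≤ corner a' b
  corner-mono-rows b a≤a' row≤1 =
    Σ<-mono a≤a' (λ i a≤i i<a' → complement-nonneg (row≤1 i a≤i i<a'))

  corner-antitone-cols : ∀ a {b b'} → b ℕ.≤ b' → (∀ j → b ℕ.≤ j → j ℕ.< b' → 0# ≤ col j a) →
                         corner a b' ≤ corner a b
  corner-antitone-cols a b≤b' col≥0 =
    stepwise (flip _≤_) ≤-refl (λ j≤i k≤j → ≤-trans k≤j j≤i) (corner a) b≤b'
      (λ j b≤j j<b' → begin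
        corner a (suc j)       ≈⟨ corner-suc-col a j ⟩
        corner a j - col j a   ≤⟨ x-d≤x (corner a j) (col≥0 j b≤j j<b') ⟩
        corner a j             ∎)

  corner-full-width : ∀ a w → (∀ i → i ℕ.< a → row i w ≈ 1#) → corner a w ≈ 0#
  corner-full-width a w row≈1 =
    Σ<-stable z≤n (λ i _ i<a → trans (+-congˡ (-‿cong (row≈1 i i<a))) (-‿inverseʳ 1#))

  corner-diagonal : ∀ n → (∀ j → j ℕ.< n → col j n ≈ 1#) →
                    (∀ i j → 2 ℕ.+ j ℕ.≤ i → i ℕ.< n → M i j ≈ 0#) →
                    ∀ a → a ℕ.< n → corner a a ≈ row a a
  corner-diagonal n col≈1 subdiag zero    _     = refl
  corner-diagonal n col≈1 subdiag (suc a) 1+a<n = begin-equality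
    corner (suc a) (suc a)                          ≈⟨ corner-suc-col (suc a) a ⟩
    (corner a a + (1# - row a a)) - col a (suc a)   ≈⟨ +-congʳ (+-congʳ IH) ⟩
    (row a a + (1# - row a a)) - col a (suc a)      ≈⟨ +-congʳ (trans (+-comm _ _) (//-rightDividesˡ (row a a) 1#)) ⟩
    1# - col a (suc a)                              ≈⟨ y≈z-x column-a ⟨
    M (suc a) a                                     ≈⟨ +-identityˡ _ ⟨
    0# + M (suc a) a                                ≈⟨ +-congʳ row-before-a ⟨
    row (suc a) (suc a)                             ∎
    where
      a<n : a ℕ.< n
      a<n = ℕP.<-trans (ℕP.n<1+n a) 1+a<n
      IH : corner a a ≈ row a a
      IH = corner-diagonal n col≈1 subdiag a a<n
      -- column a has no entries below row a+1, so its first a+2 entries sum to 1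
      column-a : col a (suc a) + M (suc a) a ≈ 1#
      column-a = trans (sym (Σ<-stable 1+a<n (λ i 2+a≤i i<n → subdiag i a 2+a≤i i<n))) (col≈1 a a<n)
      row-before-a : row (suc a) a ≈ 0#
      row-before-a = Σ<-stable z≤n (λ j _ j<a → subdiag (suc a) j (s≤s j<a) 1+a<n)

module SubdiagonalASM {c ℓ₁ ℓ₂} (K : OrderedField c ℓ₁ ℓ₂) {n} (m : Matrix K n)
  (m∈A : InA K m)
  (subdiag : ∀ i j → 2 ℕ.+ toℕ j ℕ.≤ toℕ i → OrderedField._≈_ K (m i j) (OrderedField.0# K))
  where
  open OrderedField K
  open IsTotalOrder isTotalOrder using (≲-respˡ-≈; ≲-respʳ-≈) renaming (refl to ≤-refl)
  open OrderedFieldFacts K using (poset; y≈z-x; 0≤1)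
  open PrefixSums K
  open import Relation.Binary.Reasoning.PartialOrder poset

  column-prefix≥0 : ∀ i' j → 0# ≤ sumTo K (λ i → m i j) i'
  column-prefix≥0 i' j = proj₁ (proj₁ m∈A i' j)

  row-prefix≤1 : ∀ i j' → sumTo K (λ j → m i j) j' ≤ 1#
  row-prefix≤1 i j' = proj₂ (proj₁ (proj₂ m∈A) i j')

  column-sum : ∀ j → sumAll K (λ i → m i j) ≈ 1#
  column-sum = proj₁ (proj₂ (proj₂ m∈A))

  row-sum : ∀ i → sumAll K (λ j → m i j) ≈ 1#
  row-sum = proj₂ (proj₂ (proj₂ m∈A))

  M : ℕ → ℕ → Carrier
  M i j = extend (λ x → extend (m x) j) i

  open Corners K M

  row-toℕ : ∀ x b → row (toℕ x) b ≈ Σ< b (extend (m x))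
  row-toℕ x b = Σ<-cong b (λ j _ → reflexive (extend-toℕ (λ y → extend (m y) j) x))

  col-toℕ : ∀ y a → col (toℕ y) a ≈ Σ< a (extend (λ x → m x y))
  col-toℕ y a = Σ<-cong a (λ i _ → reflexive (extend-cong (λ x → extend-toℕ (m x) y) i))

  row-total : ∀ i → i ℕ.< n → row i n ≈ 1#
  row-total = below-by-Fin (λ x → trans (row-toℕ x n) (trans (sym (sumAll-Σ< (m x))) (row-sum x)))

  col-total : ∀ j → j ℕ.< n → col j n ≈ 1#
  col-total = below-by-Fin (λ y →
    trans (col-toℕ y n) (trans (sym (sumAll-Σ< (λ x → m x y))) (column-sum y)))

  row≤1 : ∀ i b → i ℕ.< n → row i b ≤ 1#
  row≤1 i b = below-by-Fin {P = λ i → row i b ≤ 1#} (λ x →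
    ≲-respˡ-≈ (sym (row-toℕ x b))
      (extend-prefix-property (_≤ 1#) ≲-respˡ-≈ 0≤1 (m x) (row-prefix≤1 x) b)) i

  col≥0 : ∀ j a → j ℕ.< n → 0# ≤ col j a
  col≥0 j a = below-by-Fin {P = λ j → 0# ≤ col j a} (λ y →
    ≲-respʳ-≈ (sym (col-toℕ y a))
      (extend-prefix-property (0# ≤_) ≲-respʳ-≈ ≤-refl (λ x → m x y) (λ i → column-prefix≥0 i y) a)) j

  M-subdiag : ∀ i j → 2 ℕ.+ j ℕ.≤ i → i ℕ.< n → M i j ≈ 0#
  M-subdiag i j 2+j≤i i<n =
    below-by-Fin {P = λ i → 2 ℕ.+ j ℕ.≤ i → M i j ≈ 0#}
      (λ x 2+j≤x → below-by-Fin {P = λ j → 2 ℕ.+ j ℕ.≤ toℕ x → M (toℕ x) j ≈ 0#}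
        (λ y 2+y≤x → trans (reflexive (PE.trans (extend-toℕ _ x) (extend-toℕ (m x) y))) (subdiag x y 2+y≤x))
        j (ℕP.<-trans (ℕP.n<1+n j) (ℕP.<-≤-trans 2+j≤x (ℕP.<⇒≤ (FP.toℕ<n x)))) 2+j≤x)
      i i<n 2+j≤i

  cc≈corner : ∀ i j → cc K m i j ≈ corner (suc (toℕ i)) (toℕ j)
  cc≈corner i j = trans (sumTo-Σ< suffix i) (Σ<-cong (suc (toℕ i)) suffix≈)
    where
      suffix : Fin n → Carrier
      suffix i' = sumFrom K (λ j' → m i' j') j
      suffix≈ : ∀ k → k ℕ.< suc (toℕ i) → extend suffix k ≈ 1# - row k (toℕ j)
      suffix≈ k k≤i = below-by-Fin {P = λ k → extend suffix k ≈ 1# - row k (toℕ j)}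
        (λ x → trans (reflexive (extend-toℕ suffix x))
                 (trans (y≈z-x (trans (Σ<+sumFrom (m x) j) (row-sum x)))
                        (+-congˡ (-‿cong (sym (row-toℕ x (toℕ j)))))))
        k (ℕP.<-≤-trans k≤i (FP.toℕ<n i))

  cols≥0 : ∀ a {b b'} → b' ℕ.≤ n → ∀ k → b ℕ.≤ k → k ℕ.< b' → 0# ≤ col k a
  cols≥0 a b'≤n k _ k<b' = col≥0 k a (ℕP.<-≤-trans k<b' b'≤n)

  rows≤1 : ∀ b {a a'} → a' ℕ.≤ n → ∀ k → a ℕ.≤ k → k ℕ.< a' → row k b ≤ 1#
  rows≤1 b a'≤n k _ k<a' = row≤1 k b (ℕP.<-≤-trans k<a' a'≤n)

  -- Above the diagonal 0 ≤ c_{i,j} ≤ 1: squeeze c_{i,j} between the corner at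
  -- full width and the corner on the diagonal.
  cc-bounds : ∀ i j → toℕ i ℕ.< toℕ j → (0# ≤ cc K m i j) × (cc K m i j ≤ 1#)
  cc-bounds i j i<j = lower , upper
    where
      a = suc (toℕ i)
      a≤n : a ℕ.≤ n
      a≤n = FP.toℕ<n i
      a<n : a ℕ.< n
      a<n = ℕP.<-≤-trans (s≤s i<j) (FP.toℕ<n j)
      j≤n : toℕ j ℕ.≤ n
      j≤n = ℕP.<⇒≤ (FP.toℕ<n j)
      lower : 0# ≤ cc K m i j
      lower = begin
        0#               ≈⟨ corner-full-width a n (λ k k<a → row-total k (ℕP.<-≤-trans k<a a≤n)) ⟨
        corner a n       ≤⟨ corner-antitone-cols a j≤n (cols≥0 a ℕP.≤-refl) ⟩
        corner a (toℕ j) ≈⟨ cc≈corner i j ⟨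
        cc K m i j       ∎
      upper : cc K m i j ≤ 1#
      upper = begin
        cc K m i j       ≈⟨ cc≈corner i j ⟩
        corner a (toℕ j) ≤⟨ corner-antitone-cols a i<j (cols≥0 a j≤n) ⟩
        corner a a       ≈⟨ corner-diagonal n col-total M-subdiag a a<n ⟩
        row a a          ≤⟨ row≤1 a a a<n ⟩
        1#               ∎

  -- c is antitone in the order of (δ_n)^*: more rows or fewer columns
  -- enlarge the corner.
  cc-antitone : ∀ i j i' j' → toℕ i' ℕ.≤ toℕ i → toℕ j ℕ.≤ toℕ j' →
                cc K m i' j' ≤ cc K m i j
  cc-antitone i j i' j' i'≤i j≤j' = begin
    cc K m i' j'                    ≈⟨ cc≈corner i' j' ⟩
    corner (suc (toℕ i')) (toℕ j')  ≤⟨ corner-mono-rows (toℕ j') (s≤s i'≤i) (rows≤1 (toℕ j') i<n) ⟩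
    corner (suc (toℕ i)) (toℕ j')   ≤⟨ corner-antitone-cols (suc (toℕ i)) j≤j' (cols≥0 (suc (toℕ i)) j'≤n) ⟩
    corner (suc (toℕ i)) (toℕ j)    ≈⟨ cc≈corner i j ⟨
    cc K m i j                      ∎
    where
      i<n : toℕ i ℕ.< n
      i<n = FP.toℕ<n i
      j'≤n : toℕ j' ℕ.≤ n
      j'≤n = ℕP.<⇒≤ (FP.toℕ<n j')

-- Lemma 4.6.  Only membership in 𝒜(n) and the vanishing below the
-- subdiagonal are used.
lemma4p6 : ∀ {c ℓ₁ ℓ₂ : Level} (K : OrderedField c ℓ₁ ℓ₂) (n : ℕ) → n ≥ 1 →
    (lam : Fin n → ℕ) → IsPartitionIn-δ n lam →
    (m : Matrix K n) → InP K lam m →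
    InOrderPolytope K (δ∖λ n lam) _≤*_ (g K m)
lemma4p6 K n _ lam _ m (m∈A , subdiag , _) = g∈[0,1] , g-monotone
  where
    open OrderedField K using (_≤_; 0#; 1#)
    open OrderedFieldFacts K using (complement-nonneg; complement≤1; sub-antitone)
    open SubdiagonalASM K m m∈A subdiag using (cc-bounds; cc-antitone)

    g∈[0,1] : ∀ s → (0# ≤ g K m s) × (g K m s ≤ 1#)
    g∈[0,1] ((i , j) , i<j , _) with cc-bounds i j i<j
    ... | 0≤c , c≤1 = complement-nonneg c≤1 , complement≤1 0≤c

    g-monotone : ∀ s t → s ≤* t → g K m s ≤ g K m t
    g-monotone ((i , j) , _) ((i' , j') , _) (i'≤i , j≤j') =
      sub-antitone 1# (cc-antitone i j i' j' i'≤i j≤j')
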